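{- If $G$ is a connected graph of order $n$ with minimum degree $\delta$, then $i_{dR}(G)+(2\delta-1)\rho(G)\le 2n$, and this bound is sharp.
   Context: A set $R\subseteq V(G)$ is a packing if $N[x]\cap N[y]=\emptyset$ for all distinct $x,y\in R$; $\rho(G)$ is the maximum cardinality of a packing. An independent double Roman dominating function (IDRDF) on $G=(V,E)$ is a function $f:V\to\{0,1,2,3\}$ such that: every vertex $v$ with $f(v)=0$ has at least two neighbors $w$ with $f(w)=2$ or at least one neighbor $w$ with $f(w)=3$; every vertex $v$ with $f(v)=1$ has a neighbor $w$ with $f(w)\ge 2$; and $\{v: f(v)>0\}$ is independent. $i_{dR}(G)$ is the minimum weight $\sum_v f(v)$ of an IDRDF on $G$. -}

module Defs where

open import Data.Nat using (ℕ; zero; suc; _+_; _*_; _≤_; _<_)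
open import Data.Fin using (Fin; zero; suc)
open import Data.Bool using (Bool; true; false; if_then_else_)
open import Data.Product using (Σ; ∃; ∃-syntax; _×_; _,_)
open import Data.Sum using (_⊎_)
open import Relation.Binary.PropositionalEquality using (_≡_; _≢_)
open import Relation.Nullary using (¬_)

record Graph (n : ℕ) : Set where
  field
    adj   : Fin n → Fin n → Bool
    sym   : ∀ u v → adj u v ≡ adj v u
    irref : ∀ v → adj v v ≡ false
open Graph public

Adj : ∀ {n} → Graph n → Fin n → Fin n → Set
Adj G u v = adj G u v ≡ true

sumFin : ∀ {n} → (Fin n → ℕ) → ℕ
sumFin {zero}  f = 0
sumFin {suc n} f = f zero + sumFin (λ i → f (suc i))

count : ∀ {n} → (Fin n → Bool) → ℕ
count P = sumFin (λ i → if P i then 1 else 0)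

degree : ∀ {n} → Graph n → Fin n → ℕ
degree G v = count (adj G v)

IsMinDegree : ∀ {n} → Graph n → ℕ → Set
IsMinDegree G δ = (∀ v → δ ≤ degree G v) × (∃[ v ] degree G v ≡ δ)

data Reach {n} (G : Graph n) : Fin n → Fin n → Set where
  here : ∀ {v} → Reach G v v
  step : ∀ {u w v} → Adj G u w → Reach G w v → Reach G u v

Connected : ∀ {n} → Graph n → Set
Connected G = ∀ u v → Reach G u v

InClosedNbhd : ∀ {n} → Graph n → Fin n → Fin n → Set
InClosedNbhd G x z = (z ≡ x) ⊎ Adj G x z

IsPacking : ∀ {n} → Graph n → (Fin n → Bool) → Set
IsPacking G R = ∀ x y → R x ≡ true → R y ≡ true → x ≢ y →
  ∀ z → ¬ (InClosedNbhd G x z × InClosedNbhd G y z)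

IsPackingNumber : ∀ {n} → Graph n → ℕ → Set
IsPackingNumber G k =
  (∃[ R ] (IsPacking G R × count R ≡ k)) ×
  (∀ R → IsPacking G R → count R ≤ k)

record IsIDRDF {n} (G : Graph n) (f : Fin n → ℕ) : Set where
  field
    range : ∀ v → f v ≤ 3
    cond0 : ∀ v → f v ≡ 0 →
      (∃[ w₁ ] ∃[ w₂ ] (w₁ ≢ w₂ × Adj G v w₁ × Adj G v w₂ × f w₁ ≡ 2 × f w₂ ≡ 2))
      ⊎ (∃[ w ] (Adj G v w × f w ≡ 3))
    cond1 : ∀ v → f v ≡ 1 → ∃[ w ] (Adj G v w × 2 ≤ f w)
    indep : ∀ u v → 0 < f u → 0 < f v → ¬ Adj G u v

weight : ∀ {n} → (Fin n → ℕ) → ℕ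
weight f = sumFin f

IsIDRDNumber : ∀ {n} → Graph n → ℕ → Set
IsIDRDNumber G k =
  (∃[ f ] (IsIDRDF G f × weight f ≡ k)) ×
  (∀ f → IsIDRDF G f → k ≤ weight f)

module Submission where

-- Fix a packing R of G.  We build an independent double Roman
-- dominating function with values in {0,2,3} greedily, maintaining a set U of
-- vertices still to be dominated (initially all of V) such that every closed
-- neighbourhood N[x], x ∈ R, lies inside U.  One step:
--   * if R ≠ ∅, put 3 on some x ∈ R and delete N[x] from U and x from R:
--     the weight grows by 3 while |U| drops by deg x + 1 ≥ δ + 1;
--   * if R = ∅ but U spans an edge uw, put 3 on u and delete N[u] ∩ U:
--     the weight grows by 3 while |U| drops by at least 2;
--   * if U is independent, put 2 on every vertex of U.
-- The invariant  w(f) + 2δ|R| ≤ 2|U| + |R|  survives each step, and for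
-- U = V it is the claimed bound  i_dR(G) + (2δ-1)ρ(G) ≤ 2n  (taking R maximum).
--
-- Sharpness.  The complete graph K_n (n ≥ 2) has δ = n-1, ρ = 1 and
-- i_dR = 3, and 3 + 2(n-1)·1 = 2n + 1.

open import Defs hiding (sym)
open import Data.Nat using (ℕ; zero; suc; _+_; _*_; _≤_; _<_; z≤n; s≤s)
open import Data.Nat.Properties
open import Data.Nat.Tactic.RingSolver using (solve-∀)
open import Data.Fin using (Fin; zero; suc)
import Data.Fin.Properties as Fin
open import Data.Bool using (Bool; true; false; if_then_else_; _∧_; _∨_; not)
open import Data.Bool.Properties using (∨-zeroʳ; ∧-zeroʳ) renaming (_≟_ to _≟𝔹_)
open import Data.Product using (∃-syntax; _×_; _,_; proj₁; proj₂)
open import Data.Sum using (_⊎_; inj₁; inj₂)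
open import Data.Empty using (⊥-elim)
open import Relation.Nullary using (¬_; yes; no)
open import Relation.Binary.PropositionalEquality
  using (_≡_; _≢_; refl; sym; trans; cong; cong₂; subst; subst₂)

infix 4 _=ᵇ_
_=ᵇ_ : ∀ {n} → Fin n → Fin n → Bool
zero  =ᵇ zero  = true
zero  =ᵇ suc _ = false
suc _ =ᵇ zero  = false
suc a =ᵇ suc b = a =ᵇ b

=ᵇ-refl : ∀ {n} (x : Fin n) → (x =ᵇ x) ≡ true
=ᵇ-refl zero    = refl
=ᵇ-refl (suc x) = =ᵇ-refl x

=ᵇ-sound : ∀ {n} (x y : Fin n) → (x =ᵇ y) ≡ true → x ≡ y
=ᵇ-sound zero    zero    _ = refl
=ᵇ-sound (suc x) (suc y) e = cong suc (=ᵇ-sound x y e)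

=ᵇ-false : ∀ {n} (x y : Fin n) → (x =ᵇ y) ≡ false → x ≢ y
=ᵇ-false x .x e refl with () ← trans (sym (=ᵇ-refl x)) e

=ᵇ-sym : ∀ {n} (x y : Fin n) → (x =ᵇ y) ≡ (y =ᵇ x)
=ᵇ-sym zero    zero    = refl
=ᵇ-sym zero    (suc _) = refl
=ᵇ-sym (suc _) zero    = refl
=ᵇ-sym (suc x) (suc y) = =ᵇ-sym x y

∧-true : ∀ a b → a ∧ b ≡ true → (a ≡ true) × (b ≡ true)
∧-true true true _ = refl , refl

∧-intro : ∀ {a b} → a ≡ true → b ≡ true → a ∧ b ≡ true
∧-intro refl refl = refl

not-true : ∀ b → not b ≡ true → b ≡ false
not-true false _ = refl

𝟙 : Bool → ℕ
𝟙 b = if b then 1 else 0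

sumFin-cong : ∀ {n} {f g : Fin n → ℕ} → (∀ i → f i ≡ g i) → sumFin f ≡ sumFin g
sumFin-cong {zero}  _ = refl
sumFin-cong {suc n} e = cong₂ _+_ (e zero) (sumFin-cong (λ i → e (suc i)))

sumFin-+ : ∀ {n} (f g : Fin n → ℕ) → sumFin (λ i → f i + g i) ≡ sumFin f + sumFin g
sumFin-+ {zero}  f g = refl
sumFin-+ {suc n} f g =
  trans (cong (f zero + g zero +_) (sumFin-+ (λ i → f (suc i)) (λ i → g (suc i))))
        (interchange (f zero) (g zero) _ _)
  where
  interchange : ∀ a b c d → (a + b) + (c + d) ≡ (a + c) + (b + d)
  interchange = solve-∀

sumFin-mono : ∀ {n} {f g : Fin n → ℕ} → (∀ i → f i ≤ g i) → sumFin f ≤ sumFin g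
sumFin-mono {zero}  _  = z≤n
sumFin-mono {suc n} le = +-mono-≤ (le zero) (sumFin-mono (λ i → le (suc i)))

sumFin-zero : ∀ {n} → sumFin {n} (λ _ → 0) ≡ 0
sumFin-zero {zero}  = refl
sumFin-zero {suc n} = sumFin-zero {n}

sumFin-point : ∀ {n} (x : Fin n) k → sumFin (λ i → if x =ᵇ i then k else 0) ≡ k
sumFin-point {suc n} zero    k = trans (cong (k +_) (sumFin-zero {n})) (+-identityʳ k)
sumFin-point {suc n} (suc x) k = sumFin-point x k

term≤sumFin : ∀ {n} (f : Fin n → ℕ) v → f v ≤ sumFin f
term≤sumFin f zero    = m≤m+n _ _
term≤sumFin f (suc v) = ≤-trans (term≤sumFin (λ i → f (suc i)) v) (m≤n+m _ _)

count-true : ∀ {n} → count {n} (λ _ → true) ≡ n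
count-true {zero}  = refl
count-true {suc n} = cong suc (count-true {n})

count-false : ∀ {n} (P : Fin n → Bool) → (∀ x → P x ≡ false) → count P ≡ 0
count-false {n} P h = trans (sumFin-cong (λ i → cong 𝟙 (h i))) (sumFin-zero {n})

count-split : ∀ {n} (U P : Fin n → Bool) →
  count U ≡ count (λ v → U v ∧ not (P v)) + count (λ v → U v ∧ P v)
count-split U P = trans (sumFin-cong (λ v → split (U v) (P v)))
                        (sumFin-+ (λ v → 𝟙 (U v ∧ not (P v))) (λ v → 𝟙 (U v ∧ P v)))
  where
  split : ∀ a b → 𝟙 a ≡ 𝟙 (a ∧ not b) + 𝟙 (a ∧ b)
  split true  true  = refl
  split true  false = refl
  split false _     = refl

count-∩-⊆ : ∀ {n} (U P : Fin n → Bool) → (∀ v → P v ≡ true → U v ≡ true) →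
  count (λ v → U v ∧ P v) ≡ count P
count-∩-⊆ U P P⊆U = sumFin-cong pointwise
  where
  pointwise : ∀ v → 𝟙 (U v ∧ P v) ≡ 𝟙 (P v)
  pointwise v with P v in e
  ... | true  rewrite P⊆U v e = refl
  ... | false rewrite ∧-zeroʳ (U v) = refl

two≤count : ∀ {n} (P : Fin n → Bool) a b → a ≢ b → P a ≡ true → P b ≡ true → 2 ≤ count P
two≤count P a b a≢b Pa Pb =
  subst (_≤ count P)
        (trans (sumFin-+ (λ v → 𝟙 (a =ᵇ v)) (λ v → 𝟙 (b =ᵇ v)))
               (cong₂ _+_ (sumFin-point a 1) (sumFin-point b 1)))
        (sumFin-mono pointwise)
  where
  pointwise : ∀ v → 𝟙 (a =ᵇ v) + 𝟙 (b =ᵇ v) ≤ 𝟙 (P v)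
  pointwise v with a =ᵇ v in ea | b =ᵇ v in eb
  ... | true  | true  = ⊥-elim (a≢b (trans (=ᵇ-sound a v ea) (sym (=ᵇ-sound b v eb))))
  ... | true  | false rewrite sym (=ᵇ-sound a v ea) | Pa = ≤-refl
  ... | false | true  rewrite sym (=ᵇ-sound b v eb) | Pb = ≤-refl
  ... | false | false = z≤n

count≤1 : ∀ {n} (P : Fin n → Bool) → (∀ x y → P x ≡ true → P y ≡ true → x ≡ y) → count P ≤ 1
count≤1 {zero}  P unique = z≤n
count≤1 {suc n} P unique with P zero in e
... | true  = ≤-reflexive (cong suc (count-false (λ i → P (suc i)) rest))
  where
  rest : ∀ i → P (suc i) ≡ false
  rest i with P (suc i) in e′
  ... | true with () ← unique zero (suc i) e e′
  ... | false = refl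
... | false = count≤1 (λ i → P (suc i))
                      (λ x y Px Py → Fin.suc-injective (unique (suc x) (suc y) Px Py))

Adj-sym : ∀ {n} (G : Graph n) u v → Adj G u v → Adj G v u
Adj-sym G u v a = trans (Graph.sym G v u) a

Adj-irrefl : ∀ {n} (G : Graph n) v → ¬ Adj G v v
Adj-irrefl G v a with () ← trans (sym a) (irref G v)

no-witness : ∀ {n} (P : Fin n → Bool) → ¬ (∃[ x ] P x ≡ true) → ∀ x → P x ≡ false
no-witness P none x with P x in e
... | true  = ⊥-elim (none (x , e))
... | false = refl

Label : ℕ → Set
Label a = (a ≡ 0) ⊎ (a ≡ 2) ⊎ (a ≡ 3)

Label≤3 : ∀ {a} → Label a → a ≤ 3
Label≤3 (inj₁ refl)        = z≤n
Label≤3 (inj₂ (inj₁ refl)) = s≤s (s≤s z≤n)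
Label≤3 (inj₂ (inj₂ refl)) = ≤-refl

Label≢1 : ∀ {a} → Label a → a ≢ 1
Label≢1 (inj₁ refl)        ()
Label≢1 (inj₂ (inj₁ refl)) ()
Label≢1 (inj₂ (inj₂ refl)) ()

3≤weight : ∀ {n} (f : Fin n → ℕ) w → f w ≡ 3 → 3 ≤ weight f
3≤weight f w fw≡3 = subst (_≤ weight f) fw≡3 (term≤sumFin f w)

-- Arithmetic of the two "place a 3" steps: given the invariant after the
-- step (w + 2δr ≤ 3 + 2u + r for the smaller instance), recover it before.
-- Packing step: |U| grows by d + 1 with d ≥ δ, and |R| by 1.
arith-packing : ∀ w u r δ d → δ ≤ d → w + 2 * δ * r ≤ 3 + (2 * u + r) →
  w + 2 * δ * (r + 1) ≤ 2 * (u + suc d) + (r + 1)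
arith-packing w u r δ d δ≤d bound =
  subst₂ _≤_ (lhs w r δ) (rhs u r d) (+-mono-≤ bound (*-monoʳ-≤ 2 δ≤d))
  where
  lhs : ∀ w r δ → (w + 2 * δ * r) + 2 * δ ≡ w + 2 * δ * (r + 1)
  lhs = solve-∀
  rhs : ∀ u r d → (3 + (2 * u + r)) + 2 * d ≡ 2 * (u + suc d) + (r + 1)
  rhs = solve-∀

-- Edge step: |U| grows by c ≥ 2 and R is unchanged.
arith-edge : ∀ w u r δ c → 2 ≤ c → w + 2 * δ * r ≤ 3 + (2 * u + r) →
  w + 2 * δ * r ≤ 2 * (u + c) + r
arith-edge w u r δ c 2≤c bound =
  ≤-trans bound (≤-trans (n≤1+n _)
    (subst₂ _≤_ (lhs u r) (rhs u r c) (+-monoʳ-≤ (2 * u + r) (*-monoʳ-≤ 2 2≤c))))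
  where
  lhs : ∀ u r → (2 * u + r) + 2 * 2 ≡ 1 + (3 + (2 * u + r))
  lhs = solve-∀
  rhs : ∀ u r c → (2 * u + r) + 2 * c ≡ 2 * (u + c) + r
  rhs = solve-∀

module Greedy {n : ℕ} (G : Graph n) (δ : ℕ) (δ≤deg : ∀ v → δ ≤ degree G v) where

  N[_] : Fin n → Fin n → Bool
  N[ x ] z = (x =ᵇ z) ∨ adj G x z

  centre∈N : ∀ x → N[ x ] x ≡ true
  centre∈N x = cong (_∨ adj G x x) (=ᵇ-refl x)

  neighbour∈N : ∀ x z → Adj G x z → N[ x ] z ≡ true
  neighbour∈N x z a = trans (cong ((x =ᵇ z) ∨_) a) (∨-zeroʳ (x =ᵇ z))

  N→InClosedNbhd : ∀ x z → N[ x ] z ≡ true → InClosedNbhd G x z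
  N→InClosedNbhd x z e with x =ᵇ z in e₁
  ... | true  = inj₁ (sym (=ᵇ-sound x z e₁))
  ... | false = inj₂ e

  count-N : ∀ x → count N[ x ] ≡ suc (degree G x)
  count-N x =
    trans (sumFin-cong pointwise)
          (trans (sumFin-+ (λ v → 𝟙 (x =ᵇ v)) (λ v → 𝟙 (adj G x v)))
                 (cong (_+ degree G x) (sumFin-point x 1)))
    where
    pointwise : ∀ v → 𝟙 (N[ x ] v) ≡ 𝟙 (x =ᵇ v) + 𝟙 (adj G x v)
    pointwise v with x =ᵇ v in e
    ... | true with refl ← =ᵇ-sound x v e rewrite irref G x = refl
    ... | false = refl

  _∖N[_] : (Fin n → Bool) → Fin n → Fin n → Bool
  U ∖N[ x ] = λ v → U v ∧ not (N[ x ] v)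

  ∖N-excludes : ∀ U x v → N[ x ] v ≡ true → (U ∖N[ x ]) v ≡ false
  ∖N-excludes U x v e = trans (cong (λ b → U v ∧ not b) e) (∧-zeroʳ (U v))

  ∖N-smaller : ∀ U x → U x ≡ true → count (U ∖N[ x ]) < count U
  ∖N-smaller U x Ux =
    subst (count (U ∖N[ x ]) <_) (sym (count-split U N[ x ]))
          (m<m+n _ (subst (λ b → 𝟙 b ≤ count (λ v → U v ∧ N[ x ] v))
                          (∧-intro Ux (centre∈N x))
                          (term≤sumFin (λ v → 𝟙 (U v ∧ N[ x ] v)) x)))

  record Partial (U : Fin n → Bool) (f : Fin n → ℕ) : Set where
    field
      support     : ∀ v → U v ≡ false → f v ≡ 0
      labels      : ∀ v → Label (f v)
      independent : ∀ u v → 0 < f u → 0 < f v → ¬ Adj G u v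
      dominated   : ∀ v → U v ≡ true → f v ≡ 0 → ∃[ w ] (Adj G v w × f w ≡ 3)

  positive-in : ∀ U {f} → Partial U f → ∀ v → 0 < f v → U v ≡ true
  positive-in U p v pos with U v in e
  ... | true  = refl
  ... | false = ⊥-elim (<-irrefl refl (subst (0 <_) (Partial.support p v e) pos))

  place3 : Fin n → (Fin n → ℕ) → Fin n → ℕ
  place3 x f v = if x =ᵇ v then 3 else f v

  weight-place3 : ∀ x f → f x ≡ 0 → weight (place3 x f) ≡ 3 + weight f
  weight-place3 x f fx≡0 =
    trans (sumFin-cong pointwise)
          (trans (sumFin-+ (λ v → if x =ᵇ v then 3 else 0) f)
                 (cong (_+ weight f) (sumFin-point x 3)))
    where
    pointwise : ∀ v → place3 x f v ≡ (if x =ᵇ v then 3 else 0) + f v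
    pointwise v with x =ᵇ v in e
    ... | true with refl ← =ᵇ-sound x v e rewrite fx≡0 = refl
    ... | false = refl

  -- The key extension step: a 3 on x ∈ U dominates N[x], so a partial
  -- solution on U ∖ N[x] extends to one on U.
  place3-partial : ∀ U x f → U x ≡ true → Partial (U ∖N[ x ]) f → Partial U (place3 x f)
  place3-partial U x f Ux p = record
    { support = support ; labels = labels ; independent = independent ; dominated = dominated }
    where
    open Partial p renaming (support to support′; labels to labels′;
                             independent to independent′; dominated to dominated′)

    far : ∀ v → 0 < f v → ¬ Adj G x v
    far v pos a with () ← trans (sym (positive-in (U ∖N[ x ]) p v pos))
                                (∖N-excludes U x v (neighbour∈N x v a))

    support : ∀ v → U v ≡ false → place3 x f v ≡ 0
    support v Uv with x =ᵇ v in e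
    ... | true with refl ← =ᵇ-sound x v e with () ← trans (sym Ux) Uv
    ... | false = support′ v (cong (λ b → b ∧ not (N[ x ] v)) Uv)

    labels : ∀ v → Label (place3 x f v)
    labels v with x =ᵇ v
    ... | true  = inj₂ (inj₂ refl)
    ... | false = labels′ v

    independent : ∀ u v → 0 < place3 x f u → 0 < place3 x f v → ¬ Adj G u v
    independent u v pu pv a with x =ᵇ u in eu | x =ᵇ v in ev
    ... | true  | true  with refl ← =ᵇ-sound x u eu with refl ← =ᵇ-sound x v ev = Adj-irrefl G x a
    ... | true  | false with refl ← =ᵇ-sound x u eu = far v pv a
    ... | false | true  with refl ← =ᵇ-sound x v ev = far u pu (Adj-sym G u x a)
    ... | false | false = independent′ u v pu pv a

    dominated : ∀ v → U v ≡ true → place3 x f v ≡ 0 → ∃[ w ] (Adj G v w × place3 x f w ≡ 3)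
    dominated v Uv fv≡0 with x =ᵇ v in ev
    dominated v Uv () | true
    ... | false with adj G x v in av
    ...   | true  = x , Adj-sym G x v av , cong (λ b → if b then 3 else f x) (=ᵇ-refl x)
    ...   | false with dominated′ v v∈U∖N fv≡0
      where
      v∈U∖N : (U ∖N[ x ]) v ≡ true
      v∈U∖N rewrite Uv | ev | av = refl
    ...     | w , a , fw≡3 = w , a , labelled
      where
      labelled : place3 x f w ≡ 3
      labelled with x =ᵇ w
      ... | true  = refl
      ... | false = fw≡3

  PackedIn : (Fin n → Bool) → (Fin n → Bool) → Set
  PackedIn U R = (∀ x → R x ≡ true → ∀ z → N[ x ] z ≡ true → U z ≡ true) × IsPacking G R

  Achievable : (Fin n → Bool) → (Fin n → Bool) → Set
  Achievable U R = ∃[ f ] (Partial U f × weight f + 2 * δ * count R ≤ 2 * count U + count R)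

  Smaller : (Fin n → Bool) → Set
  Smaller U = ∀ U′ R′ → count U′ < count U → PackedIn U′ R′ → Achievable U′ R′

  place-at : ∀ U R′ x → U x ≡ true → Smaller U → PackedIn (U ∖N[ x ]) R′ →
    ∃[ f ] (Partial U f × weight f + 2 * δ * count R′ ≤ 3 + (2 * count (U ∖N[ x ]) + count R′))
  place-at U R′ x Ux smaller packed
    with smaller (U ∖N[ x ]) R′ (∖N-smaller U x Ux) packed
  ... | f , p , bound = place3 x f , place3-partial U x f Ux p , extended-bound
    where
    open ≤-Reasoning
    extended-bound : weight (place3 x f) + 2 * δ * count R′ ≤ 3 + (2 * count (U ∖N[ x ]) + count R′)
    extended-bound = begin
      weight (place3 x f) + 2 * δ * count R′
        ≡⟨ cong (_+ 2 * δ * count R′)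
                (weight-place3 x f (Partial.support p x (∖N-excludes U x x (centre∈N x)))) ⟩
      3 + weight f + 2 * δ * count R′   ≡⟨ +-assoc 3 (weight f) _ ⟩
      3 + (weight f + 2 * δ * count R′) ≤⟨ +-monoʳ-≤ 3 bound ⟩
      3 + (2 * count (U ∖N[ x ]) + count R′) ∎

  -- Case R ≠ ∅: place 3 on x ∈ R; since N[x] ⊆ U, |U| drops by deg x + 1,
  -- and R ∖ {x} is a packing inside U ∖ N[x].
  packing-step : ∀ U R x → PackedIn U R → R x ≡ true → Smaller U → Achievable U R
  packing-step U R x (R⊆U , packing) Rx smaller =
    finish (place-at U R′ x (R⊆U x Rx x (centre∈N x)) smaller (R′⊆U′ , packing′))
    where
    U′ R′ : Fin n → Bool
    U′ = U ∖N[ x ]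
    R′ = λ v → R v ∧ not (x =ᵇ v)

    R′⊆U′ : ∀ y → R′ y ≡ true → ∀ z → N[ y ] z ≡ true → U′ z ≡ true
    R′⊆U′ y R′y z Nyz with ∧-true (R y) _ R′y
    ... | Ry , x≠y with N[ x ] z in Nxz
    ...   | false rewrite R⊆U y Ry z Nyz = refl
    ...   | true  = ⊥-elim (packing x y Rx Ry (=ᵇ-false x y (not-true _ x≠y)) z
                                   (N→InClosedNbhd x z Nxz , N→InClosedNbhd y z Nyz))

    packing′ : IsPacking G R′
    packing′ a b R′a R′b = packing a b (proj₁ (∧-true (R a) _ R′a)) (proj₁ (∧-true (R b) _ R′b))

    |U| : count U ≡ count U′ + suc (degree G x)
    |U| = trans (count-split U N[ x ])
                (cong (count U′ +_) (trans (count-∩-⊆ U N[ x ] (R⊆U x Rx)) (count-N x)))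

    |R| : count R ≡ count R′ + 1
    |R| = trans (count-split R (x =ᵇ_))
                (cong (count R′ +_) (trans (count-∩-⊆ R (x =ᵇ_) x∈R) (sumFin-point x 1)))
      where
      x∈R : ∀ v → (x =ᵇ v) ≡ true → R v ≡ true
      x∈R v e with refl ← =ᵇ-sound x v e = Rx

    finish : ∃[ f ] (Partial U f × weight f + 2 * δ * count R′ ≤ 3 + (2 * count U′ + count R′)) →
      Achievable U R
    finish (f , p , bound) =
      f , p , subst₂ (λ r u → weight f + 2 * δ * r ≤ 2 * u + r) (sym |R|) (sym |U|)
                     (arith-packing (weight f) (count U′) (count R′) δ (degree G x) (δ≤deg x) bound)

  -- Case R = ∅ and U spans an edge uw: place 3 on u; |U| drops by at least 2.
  edge-step : ∀ U R u w → IsPacking G R → (∀ x → R x ≡ false) →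
    U u ≡ true → U w ≡ true → Adj G u w → Smaller U → Achievable U R
  edge-step U R u w packing R≡∅ Uu Uw uw smaller =
    finish (place-at U R u Uu smaller (R⊆U′ , packing))
    where
    U′ : Fin n → Bool
    U′ = U ∖N[ u ]

    R⊆U′ : ∀ y → R y ≡ true → ∀ z → N[ y ] z ≡ true → U′ z ≡ true
    R⊆U′ y Ry with () ← trans (sym Ry) (R≡∅ y)

    2≤|U∩N[u]| : 2 ≤ count (λ v → U v ∧ N[ u ] v)
    2≤|U∩N[u]| = two≤count _ u w (λ { refl → Adj-irrefl G u uw })
                            (∧-intro Uu (centre∈N u)) (∧-intro Uw (neighbour∈N u w uw))

    finish : ∃[ f ] (Partial U f × weight f + 2 * δ * count R ≤ 3 + (2 * count U′ + count R)) →
      Achievable U R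
    finish (f , p , bound) =
      f , p , subst (λ m → weight f + 2 * δ * count R ≤ 2 * m + count R) (sym (count-split U N[ u ]))
                    (arith-edge (weight f) (count U′) (count R) δ _ 2≤|U∩N[u]| bound)

  independent-step : ∀ U R → (∀ x → R x ≡ false) →
    (∀ u v → U u ≡ true → U v ≡ true → ¬ Adj G u v) → Achievable U R
  independent-step U R R≡∅ U-indep = f , partial , bound
    where
    f : Fin n → ℕ
    f v = if U v then 2 else 0

    positive⇒U : ∀ v → 0 < f v → U v ≡ true
    positive⇒U v pos with U v
    ... | true = refl

    partial : Partial U f
    partial = record
      { support     = λ v Uv → cong (λ b → if b then 2 else 0) Uv
      ; labels      = labels
      ; independent = λ u v pu pv → U-indep u v (positive⇒U u pu) (positive⇒U v pv)
      ; dominated   = dominated }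
      where
      labels : ∀ v → Label (f v)
      labels v with U v
      ... | true  = inj₂ (inj₁ refl)
      ... | false = inj₁ refl
      dominated : ∀ v → U v ≡ true → f v ≡ 0 → ∃[ w ] (Adj G v w × f w ≡ 3)
      dominated v Uv fv≡0 with () ← trans (sym (cong (λ b → if b then 2 else 0) Uv)) fv≡0

    doubled : ∀ v → f v ≡ 𝟙 (U v) + 𝟙 (U v)
    doubled v with U v
    ... | true  = refl
    ... | false = refl

    bound : weight f + 2 * δ * count R ≤ 2 * count U + count R
    bound rewrite count-false R R≡∅ =
      ≤-reflexive (trans (cong (_+ 2 * δ * 0)
                                (trans (sumFin-cong doubled) (sumFin-+ (λ v → 𝟙 (U v)) (λ v → 𝟙 (U v)))))
                         (twice (count U) δ))
      where
      twice : ∀ c δ → (c + c) + 2 * δ * 0 ≡ 2 * c + 0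
      twice = solve-∀

  greedy-step : ∀ U R → PackedIn U R → Smaller U → Achievable U R
  greedy-step U R packed smaller with Fin.any? (λ x → R x ≟𝔹 true)
  ... | yes (x , Rx) = packing-step U R x packed Rx smaller
  ... | no R≢∅ with Fin.any? (λ u → Fin.any? (λ w → (U u ∧ (U w ∧ adj G u w)) ≟𝔹 true))
  ...   | yes (u , w , e) with ∧-true (U u) _ e
  ...     | Uu , e′ with ∧-true (U w) _ e′
  ...       | Uw , uw = edge-step U R u w (proj₂ packed) (no-witness R R≢∅) Uu Uw uw smaller
  greedy-step U R packed smaller | no R≢∅ | no no-edge =
    independent-step U R (no-witness R R≢∅)
      (λ u v Uu Uv uv → no-edge (u , v , ∧-intro Uu (∧-intro Uv uv)))

  -- Strong induction on |U|, with the fuel k bounding |U|.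
  achievable : ∀ k U R → count U ≤ k → PackedIn U R → Achievable U R
  achievable zero U R |U|≤0 packed =
    greedy-step U R packed (λ _ _ lt _ → ⊥-elim (<⇒≱ (≤-trans lt |U|≤0) z≤n))
  achievable (suc k) U R |U|≤k packed =
    greedy-step U R packed (λ U′ R′ lt → achievable k U′ R′ (≤-pred (≤-trans lt |U|≤k)))

  partial→IDRDF : ∀ f → Partial (λ _ → true) f → IsIDRDF G f
  partial→IDRDF f p = record
    { range = λ v → Label≤3 (labels v)
    ; cond0 = λ v fv≡0 → inj₂ (dominated v refl fv≡0)
    ; cond1 = λ v fv≡1 → ⊥-elim (Label≢1 (labels v) fv≡1)
    ; indep = independent }
    where open Partial p

  idrdf-with-packing : ∀ R → IsPacking G R →
    ∃[ f ] (IsIDRDF G f × weight f + 2 * δ * count R ≤ 2 * n + count R)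
  idrdf-with-packing R packing
    with achievable n (λ _ → true) R (≤-reflexive (count-true {n})) ((λ _ _ _ _ → refl) , packing)
  ... | f , p , bound =
    f , partial→IDRDF f p , subst (λ m → weight f + 2 * δ * count R ≤ 2 * m + count R) (count-true {n}) bound

-- Upper bound: i_dR(G) + (2δ - 1)ρ(G) ≤ 2n, written in ℕ.
idr-packing-bound : ∀ (n : ℕ) (G : Graph n) (δ i ρ : ℕ) → IsMinDegree G δ →
  IsIDRDNumber G i → IsPackingNumber G ρ → i + 2 * δ * ρ ≤ 2 * n + ρ
idr-packing-bound n G δ i ρ (δ≤deg , _) (_ , i-min) ((R , packing , |R|≡ρ) , _)
  with Greedy.idrdf-with-packing G δ δ≤deg R packing
... | f , idrdf , bound =
  ≤-trans (+-monoˡ-≤ (2 * δ * ρ) (i-min f idrdf))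
          (subst (λ r → weight f + 2 * δ * r ≤ 2 * n + r) |R|≡ρ bound)

K : ∀ n → Graph n
K n = record
  { adj = λ u v → not (u =ᵇ v)
  ; sym = λ u v → cong not (=ᵇ-sym u v)
  ; irref = λ v → cong not (=ᵇ-refl v) }

K-adj : ∀ {n} (u v : Fin n) → u ≢ v → Adj (K n) u v
K-adj u v u≢v with u =ᵇ v in e
... | true  = ⊥-elim (u≢v (=ᵇ-sound u v e))
... | false = refl

K-connected : ∀ n → Connected (K n)
K-connected n u v with u Fin.≟ v
... | yes refl = here
... | no  u≢v  = step (K-adj u v u≢v) here

-- K_{m+1} is m-regular: V = N[v] splits as {v} plus the m other vertices.
K-degree : ∀ m (v : Fin (suc m)) → degree (K (suc m)) v ≡ m
K-degree m v = +-cancelʳ-≡ 1 _ m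
  (trans (sym (cong (degree (K (suc m)) v +_) (sumFin-point v 1)))
         (trans (sym (count-split (λ _ → true) (v =ᵇ_))) (trans (count-true {suc m}) (+-comm 1 m))))

K-one-positive : ∀ {n f} → IsIDRDF (K n) f → ∀ u v → 0 < f u → 0 < f v → u ≡ v
K-one-positive idrdf u v pu pv with u Fin.≟ v
... | yes u≡v = u≡v
... | no  u≢v = ⊥-elim (IsIDRDF.indep idrdf u v pu pv (K-adj u v u≢v))

-- Hence, with n ≥ 2, some vertex is labelled 0 ...
K-zero-vertex : ∀ k f → IsIDRDF (K (suc (suc k))) f → ∃[ v ] f v ≡ 0
K-zero-vertex k f idrdf with f zero in e₀
... | zero = zero , e₀
... | suc a with f (suc zero) in e₁
...   | zero  = suc zero , e₁
...   | suc b with () ← K-one-positive idrdf zero (suc zero)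
                            (subst (0 <_) (sym e₀) (s≤s z≤n)) (subst (0 <_) (sym e₁) (s≤s z≤n))

-- ... and it must see a 3, since two distinct 2's are impossible: i_dR(K_n) ≥ 3.
K-weight≥3 : ∀ k f → IsIDRDF (K (suc (suc k))) f → 3 ≤ weight f
K-weight≥3 k f idrdf with K-zero-vertex k f idrdf
... | v , fv≡0 with IsIDRDF.cond0 idrdf v fv≡0
...   | inj₂ (w , _ , fw≡3) = 3≤weight f w fw≡3
...   | inj₁ (w₁ , w₂ , w₁≢w₂ , _ , _ , f₁≡2 , f₂≡2) =
  ⊥-elim (w₁≢w₂ (K-one-positive idrdf w₁ w₂ (two-positive f₁≡2) (two-positive f₂≡2)))
  where
  two-positive : ∀ {a} → a ≡ 2 → 0 < a
  two-positive refl = s≤s z≤n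

hub : ∀ {m} → Fin (suc m) → ℕ
hub v = if zero =ᵇ v then 3 else 0

hub-label : ∀ {m} (v : Fin (suc m)) → Label (hub v)
hub-label zero    = inj₂ (inj₂ refl)
hub-label (suc v) = inj₁ refl

hub-positive : ∀ {m} (v : Fin (suc m)) → 0 < hub v → v ≡ zero
hub-positive zero _ = refl

hub-idrdf : ∀ m → IsIDRDF (K (suc m)) hub
hub-idrdf m = record
  { range = λ v → Label≤3 (hub-label v)
  ; cond0 = λ v hv≡0 → inj₂ (zero , K-adj v zero (off-hub v hv≡0) , refl)
  ; cond1 = λ v hv≡1 → ⊥-elim (Label≢1 (hub-label v) hv≡1)
  ; indep = independent }
  where
  off-hub : ∀ v → hub v ≡ 0 → v ≢ zero
  off-hub (suc v) _ ()
  independent : ∀ u v → 0 < hub u → 0 < hub v → ¬ Adj (K (suc m)) u v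
  independent u v pu pv with refl ← hub-positive u pu with refl ← hub-positive v pv =
    Adj-irrefl (K (suc m)) zero

K-packing≤1 : ∀ n R → IsPacking (K n) R → count R ≤ 1
K-packing≤1 n R packing = count≤1 R unique
  where
  unique : ∀ x y → R x ≡ true → R y ≡ true → x ≡ y
  unique x y Rx Ry with x Fin.≟ y
  ... | yes x≡y = x≡y
  ... | no  x≢y = ⊥-elim (packing x y Rx Ry x≢y x (inj₁ refl , inj₂ (K-adj y x (λ y≡x → x≢y (sym y≡x)))))

singleton-packing : ∀ m → IsPacking (K (suc m)) (zero =ᵇ_)
singleton-packing m x y R₀x R₀y x≢y =
  ⊥-elim (x≢y (trans (sym (=ᵇ-sound zero x R₀x)) (=ᵇ-sound zero y R₀y)))

complete-graph-sharp : ∀ (n : ℕ) → 2 ≤ n → ∃[ G ] ∃[ δ ] ∃[ i ] ∃[ ρ ]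
  (Connected {n} G × IsMinDegree G δ × IsIDRDNumber G i × IsPackingNumber G ρ ×
   i + 2 * δ * ρ ≡ 2 * n + ρ)
complete-graph-sharp (suc (suc k)) (s≤s (s≤s z≤n)) =
  K n , suc k , 3 , 1 ,
  K-connected n ,
  ((λ v → ≤-reflexive (sym (K-degree (suc k) v))) , (zero , K-degree (suc k) zero)) ,
  ((hub , hub-idrdf (suc k) , sumFin-point {n} zero 3) , K-weight≥3 k) ,
  ((_=ᵇ_ zero , singleton-packing (suc k) , sumFin-point {n} zero 1) , K-packing≤1 n) ,
  equality k
  where
  n : ℕ
  n = suc (suc k)
  equality : ∀ m → 3 + 2 * suc m * 1 ≡ 2 * suc (suc m) + 1
  equality = solve-∀

proposition12 :
    (∀ (n : ℕ) (G : Graph n) (δ i ρ : ℕ) → Connected G → IsMinDegree G δ →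
      IsIDRDNumber G i → IsPackingNumber G ρ →
      i + 2 * δ * ρ ≤ 2 * n + ρ)
    ×
    (∀ (n : ℕ) → 2 ≤ n → ∃[ G ] ∃[ δ ] ∃[ i ] ∃[ ρ ]
      (Connected {n} G × IsMinDegree G δ × IsIDRDNumber G i × IsPackingNumber G ρ ×
       i + 2 * δ * ρ ≡ 2 * n + ρ))
proposition12 =
  (λ n G δ i ρ _ → idr-packing-bound n G δ i ρ) ,
  complete-graph-sharp
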